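{- Let $G$ be a directed graph, $T\subseteq V(G)$ and $k$ a nonnegative integer, and let $\mathcal{I}_k$ be as defined below. For any vertex $z$, there are at most $4^{k}$ members of $\mathcal{I}_k$ that contain $z$ in their exact reverse shadows.
   Context: $G$ has a (possibly empty) set $V^\infty(G)$ of undeletable vertices. For disjoint nonempty $A,B\subseteq V(G)$, a set $W\subseteq V(G)\setminus(A\cup B\cup V^\infty(G))$ is an $A-B$ separator if $G\setminus W$ has no path from $A$ to $B$; it is minimal if no proper subset is an $A-B$ separator. We write $v-T$ for $\{v\}-T$. $R^+_H(A)$ is the set of vertices reachable from $A$ in $H$. A minimal $A-B$ separator $W$ is important if there is no $A-B$ separator $W'$ with $|W'|\le|W|$ and $R^+_{G\setminus W}(A)\subsetneq R^+_{G\setminus W'}(A)$. $\mathcal{I}_k$ is the collection of sets $W\subseteq V(G)$ such that $W$ is an important $v-T$ separator of size at most $k$ for some vertex $v\in V(G)\setminus T$. A vertex $v$ is in the exact reverse shadow of $W$ (with respect to $T$) if $W$ is a minimal $v-T$ separator. -}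

module Defs where

open import Data.Nat using (ℕ; _≤_)
open import Data.Fin using (Fin)
open import Data.Fin.Subset using (Subset; _∈_; _∉_; _⊂_; ∣_∣; Nonempty; ⁅_⁆)
open import Data.Bool using (Bool; true)
open import Data.Product using (Σ; ∃; _×_)
open import Relation.Nullary using (¬_)
open import Relation.Binary.PropositionalEquality using (_≡_)

-- A finite directed graph on vertex set Fin n, given by its (directed)
-- adjacency relation: E u w ≡ true iff there is an arc u → w.
Digraph : ℕ → Set
Digraph n = Fin n → Fin n → Bool

module _ {n : ℕ} (E : Digraph n) where

  data Path (W : Subset n) : Fin n → Fin n → Set where
    here : ∀ {v} → v ∉ W → Path W v v
    step : ∀ {u w v} → u ∉ W → E u w ≡ true → Path W w v → Path W u v

  Reach : Subset n → Subset n → Fin n → Set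
  Reach W A v = ∃ λ a → a ∈ A × Path W a v

  module _ (V∞ : Subset n) where

    IsSep : Subset n → Subset n → Subset n → Set
    IsSep A B W =
      Nonempty A × Nonempty B × (∀ x → x ∈ A → x ∉ B) ×
      (∀ x → x ∈ W → x ∉ A × x ∉ B × x ∉ V∞) ×
      (∀ a b → a ∈ A → b ∈ B → ¬ Path W a b)

    IsMinSep : Subset n → Subset n → Subset n → Set
    IsMinSep A B W = IsSep A B W × (∀ W' → W' ⊂ W → ¬ IsSep A B W')

    IsImportant : Subset n → Subset n → Subset n → Set
    IsImportant A B W =
      IsMinSep A B W ×
      ¬ (Σ (Subset n) λ W' → IsSep A B W' × ∣ W' ∣ ≤ ∣ W ∣ ×
          (∀ x → Reach W A x → Reach W' A x) ×
          (∃ λ x → Reach W' A x × ¬ Reach W A x))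

    -- W ∈ 𝓘_k (with respect to T)
    InI : Subset n → ℕ → Subset n → Set
    InI T k W = ∃ λ v → v ∉ T × IsImportant ⁅ v ⁆ T W × ∣ W ∣ ≤ k

    InExactRevShadow : Subset n → Subset n → Fin n → Set
    InExactRevShadow T W z = IsMinSep ⁅ z ⁆ T W

module Submission where

-- Such a member W is an important v–T separator that is also a minimal z–T
-- separator; the shadow transfer (module ShadowTransfer) shows that W is then
-- an important z–T separator.  It remains to count important z–T separators
-- of size ≤ k, by the branching argument of Chen, Liu and Lu / Marx.  We work
-- with cuts between a source set S and T in G − D for a set D of deleted
-- vertices, and let λ be the minimum cut size.  Submodularity of the boundary
-- size (module Cuts) gives an extremal minimum cut C whose reach set every
-- important cut reaches (module MinimumCuts).  For a vertex u on the boundary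
-- of that reach set, important cuts containing u lose u when u is deleted
-- (k and λ drop by one), and those avoiding u stay important when u joins the
-- sources (λ grows); either way 2k − λ drops, so there are at most
-- 2^(2k − λ) ≤ 2^(2k) = 4^k of them (module Counting).

open import Defs
open import Data.Nat using (ℕ; zero; suc; pred; _≤_; _+_; _∸_; z≤n; s≤s; s≤s⁻¹; _≤?_; _^_)
open import Data.Nat.Properties hiding (_≟_)
open import Data.Fin using (Fin; _≟_)
open import Data.Fin.Properties using (any?; all?)
open import Data.Fin.Subset
open import Data.Fin.Subset.Properties
open import Data.Bool using (true; false) renaming (_≟_ to _≟ᵇ_)
open import Data.Vec using ([]; _∷_; tabulate)
open import Data.Vec.Properties using (lookup∘tabulate; lookup⇒[]=; []=⇒lookup)
open import Data.Product using (∃; ∃₂; _×_; _,_; proj₁; proj₂)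
open import Data.Sum using (_⊎_; inj₁; inj₂; [_,_]′)
open import Data.Empty using (⊥-elim)
open import Relation.Nullary using (Dec; yes; no; ¬_; does; ¬?)
open import Relation.Nullary.Decidable using (dec-true; _×-dec_; _→-dec_; map′)
open import Relation.Unary using (Decidable)
open import Relation.Unary.Properties using (∁?)
open import Data.List using (List; []; _∷_; length; map; filter)
open import Data.List.Relation.Unary.All using (All; []; _∷_)
import Data.List.Relation.Unary.All as All
import Data.List.Relation.Unary.All.Properties as Allₚ
open import Data.List.Relation.Unary.Unique.Propositional using (Unique; []; _∷_)
import Data.List.Relation.Unary.Unique.Propositional.Properties as Uniqueₚ
open import Data.List.Properties using (length-map)
open import Relation.Binary.PropositionalEquality
open import Function using (_∘_)

module _ {n : ℕ} {P : Fin n → Set} (P? : Decidable P) where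

  select : Subset n
  select = tabulate (λ x → does (P? x))

  ∈-select⁺ : ∀ {x} → P x → x ∈ select
  ∈-select⁺ {x} px = lookup⇒[]= x select (trans (lookup∘tabulate _ x) (dec-true (P? x) px))

  ∈-select⁻ : ∀ {x} → x ∈ select → P x
  ∈-select⁻ {x} x∈ with P? x | trans (sym (lookup∘tabulate (λ y → does (P? y)) x)) ([]=⇒lookup x∈)
  ... | yes px | _ = px
  ... | no _   | ()

∣p∪q∣+∣p∩q∣≡∣p∣+∣q∣ : ∀ {n} (p q : Subset n) → ∣ p ∪ q ∣ + ∣ p ∩ q ∣ ≡ ∣ p ∣ + ∣ q ∣
∣p∪q∣+∣p∩q∣≡∣p∣+∣q∣ [] [] = refl
∣p∪q∣+∣p∩q∣≡∣p∣+∣q∣ (true ∷ p) (true ∷ q) =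
  cong suc (trans (+-suc _ _) (trans (cong suc (∣p∪q∣+∣p∩q∣≡∣p∣+∣q∣ p q)) (sym (+-suc _ _))))
∣p∪q∣+∣p∩q∣≡∣p∣+∣q∣ (true ∷ p) (false ∷ q) = cong suc (∣p∪q∣+∣p∩q∣≡∣p∣+∣q∣ p q)
∣p∪q∣+∣p∩q∣≡∣p∣+∣q∣ (false ∷ p) (true ∷ q) = trans (cong suc (∣p∪q∣+∣p∩q∣≡∣p∣+∣q∣ p q)) (sym (+-suc _ _))
∣p∪q∣+∣p∩q∣≡∣p∣+∣q∣ (false ∷ p) (false ∷ q) = ∣p∪q∣+∣p∩q∣≡∣p∣+∣q∣ p q

∣p∪q∣≤∣p∣+∣q∣ : ∀ {n} (p q : Subset n) → ∣ p ∪ q ∣ ≤ ∣ p ∣ + ∣ q ∣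
∣p∪q∣≤∣p∣+∣q∣ p q = ≤-trans (m≤m+n _ _) (≤-reflexive (∣p∪q∣+∣p∩q∣≡∣p∣+∣q∣ p q))

∣p∪⁅x⁆∣≡1+∣p∣ : ∀ {n} (p : Subset n) x → x ∉ p → ∣ p ∪ ⁅ x ⁆ ∣ ≡ suc ∣ p ∣
∣p∪⁅x⁆∣≡1+∣p∣ {n} p x x∉p = begin
    ∣ p ∪ ⁅ x ⁆ ∣                  ≡⟨ sym (+-identityʳ _) ⟩
    ∣ p ∪ ⁅ x ⁆ ∣ + 0              ≡⟨ cong (∣ p ∪ ⁅ x ⁆ ∣ +_) (sym ∣p∩⁅x⁆∣≡0) ⟩
    ∣ p ∪ ⁅ x ⁆ ∣ + ∣ p ∩ ⁅ x ⁆ ∣  ≡⟨ ∣p∪q∣+∣p∩q∣≡∣p∣+∣q∣ p ⁅ x ⁆ ⟩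
    ∣ p ∣ + ∣ ⁅ x ⁆ ∣              ≡⟨ cong (∣ p ∣ +_) (∣⁅x⁆∣≡1 x) ⟩
    ∣ p ∣ + 1                      ≡⟨ +-comm _ 1 ⟩
    suc ∣ p ∣                      ∎
  where
  open ≡-Reasoning
  ∣p∩⁅x⁆∣≡0 : ∣ p ∩ ⁅ x ⁆ ∣ ≡ 0
  ∣p∩⁅x⁆∣≡0 = trans (cong ∣_∣ (Empty-unique λ (y , y∈) →
    let (y∈p , y∈x) = x∈p∩q⁻ p ⁅ x ⁆ y∈ in x∉p (subst (_∈ p) (x∈⁅y⁆⇒x≡y x y∈x) y∈p))) (∣⊥∣≡0 n)

∉∪ : ∀ {n} {p q : Subset n} {x} → x ∉ p → x ∉ q → x ∉ p ∪ q
∉∪ {p = p} x∉p x∉q x∈ = [ x∉p , x∉q ]′ (x∈p∪q⁻ p _ x∈)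

∈∪ˡ : ∀ {n} {p q : Subset n} {x} → x ∈ p → x ∈ p ∪ q
∈∪ˡ x∈ = x∈p∪q⁺ (inj₁ x∈)

∈∪ʳ : ∀ {n} {p q : Subset n} {x} → x ∈ q → x ∈ p ∪ q
∈∪ʳ x∈ = x∈p∪q⁺ (inj₂ x∈)

∪-rearrange : ∀ {n} (p q r : Subset n) → (p ∪ q) ∪ r ≡ p ∪ (r ∪ q)
∪-rearrange p q r = trans (∪-assoc p q r) (cong (p ∪_) (∪-comm q r))

∪∁-anti : ∀ {n} {D Y Z : Subset n} → Y ⊆ Z → D ∪ ∁ Z ⊆ D ∪ ∁ Y
∪∁-anti {D = D} Y⊆Z x∈ =
  [ ∈∪ˡ , (λ x∈∁Z → ∈∪ʳ (x∉p⇒x∈∁p (λ x∈Y → x∈p⇒x∉∁p (Y⊆Z x∈Y) x∈∁Z))) ]′ (x∈p∪q⁻ D _ x∈)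

minimiser : ∀ {n} {Q : Subset n → Set} → Decidable Q → (f : Subset n → ℕ) → ∃ Q →
            ∃ λ x → Q x × ∀ y → Q y → f x ≤ f y
minimiser {Q = Q} Q? f (y , qy) = descend (f y) (y , qy , ≤-refl)
  where
  descend : ∀ b → (∃ λ y → Q y × f y ≤ b) → ∃ λ x → Q x × ∀ y → Q y → f x ≤ f y
  descend zero    (y , qy , fy≤0) = y , qy , λ _ _ → ≤-trans fy≤0 z≤n
  descend (suc b) (y , qy , fy≤b+1) with anySubset? (λ y → Q? y ×-dec (f y ≤? b))
  ... | yes lower = descend b lower
  ... | no ¬lower = y , qy , λ y' qy' → ≤-trans fy≤b+1 (≰⇒> λ fy'≤b → ¬lower (y' , qy' , fy'≤b))

length-split : ∀ {A : Set} {P : A → Set} (P? : Decidable P) xs →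
               length xs ≡ length (filter P? xs) + length (filter (∁? P?) xs)
length-split P? [] = refl
length-split P? (x ∷ xs) with P? x
... | yes _ = cong suc (length-split P? xs)
... | no _  = trans (cong suc (length-split P? xs)) (sym (+-suc _ _))

map⁺-injectiveOn : ∀ {A B : Set} {Q : A → Set} (f : A → B) → (∀ {x y} → Q x → Q y → f x ≡ f y → x ≡ y) →
                   ∀ {xs} → All Q xs → Unique xs → Unique (map f xs)
map⁺-injectiveOn f inj [] [] = []
map⁺-injectiveOn f inj (qx ∷ qxs) (x∉xs ∷ uniq) =
  Allₚ.map⁺ (All.zipWith (λ (qy , x≢y) fx≡fy → x≢y (inj qx qy fx≡fy)) (qxs , x∉xs)) ∷ map⁺-injectiveOn f inj qxs uniq

atMostOne : ∀ {A : Set} {c : A} {xs} → Unique xs → All (_≡ c) xs → length xs ≤ 1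
atMostOne {xs = []} _ _ = z≤n
atMostOne {xs = _ ∷ []} _ _ = s≤s z≤n
atMostOne {xs = _ ∷ _ ∷ _} ((x≢y ∷ _) ∷ _) (x≡c ∷ y≡c ∷ _) = ⊥-elim (x≢y (trans x≡c (sym y≡c)))

-- Arithmetic of the budget m ≥ 2k − l of the counting argument.
budget-large : ∀ {k l m} → k + k ≤ l + m → l ≤ k → k ≤ m
budget-large {k} {l} {m} budget l≤k = +-cancelˡ-≤ k k m (≤-trans budget (+-monoˡ-≤ m l≤k))

budget-push : ∀ {k l c m} → k + k ≤ l + suc m → l ≤ c → k + k ≤ suc c + m
budget-push {k} {l} {c} {m} budget l≤c = ≤-trans budget (≤-trans (+-monoˡ-≤ (suc m) l≤c) (≤-reflexive (+-suc c m)))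

budget-delete : ∀ {k l c m} → k + k ≤ l + suc m → l ≤ c → 1 ≤ c → c ≤ k → pred k + pred k ≤ pred c + m
budget-delete {suc k} {l} {suc c} {m} budget l≤c _ _ = s≤s⁻¹ (s≤s⁻¹ (begin
  suc (suc (k + k))  ≡⟨ cong suc (sym (+-suc k k)) ⟩
  suc k + suc k      ≤⟨ budget-push {suc k} budget l≤c ⟩
  suc (suc (c + m))  ∎))
  where open ≤-Reasoning

module Paths {n : ℕ} (E : Digraph n) where

  P : Subset n → Fin n → Fin n → Set
  P = Path E

  start∉ : ∀ {X a b} → P X a b → a ∉ X
  start∉ (here a∉) = a∉
  start∉ (step a∉ _ _) = a∉

  end∉ : ∀ {X a b} → P X a b → b ∉ X
  end∉ (here b∉) = b∉
  end∉ (step _ _ p) = end∉ p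

  P-mono : ∀ {X Y a b} → X ⊆ Y → P Y a b → P X a b
  P-mono X⊆Y (here b∉) = here (λ b∈ → b∉ (X⊆Y b∈))
  P-mono X⊆Y (step a∉ e p) = step (λ a∈ → a∉ (X⊆Y a∈)) e (P-mono X⊆Y p)

  snoc : ∀ {X a b c} → P X a b → E b c ≡ true → c ∉ X → P X a c
  snoc (here b∉) e c∉ = step b∉ e (here c∉)
  snoc (step a∉ e′ p) e c∉ = step a∉ e′ (snoc p e c∉)

  _++ᴾ_ : ∀ {X a b c} → P X a b → P X b c → P X a c
  here _ ++ᴾ q = q
  step a∉ e p ++ᴾ q = step a∉ e (p ++ᴾ q)

  exitArc : ∀ {X Q : Subset n} {a b} → P X a b → a ∈ Q → b ∉ Q →
            ∃₂ λ c d → c ∈ Q × d ∉ Q × E c d ≡ true × d ∉ X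
  exitArc (here _) a∈Q b∉Q = ⊥-elim (b∉Q a∈Q)
  exitArc {Q = Q} {a} (step {w = c} _ e p) a∈Q b∉Q with c ∈? Q
  ... | yes c∈Q = exitArc p c∈Q b∉Q
  ... | no c∉Q = a , c , a∈Q , c∉Q , e , start∉ p

  ShortcutFrom : Subset n → Fin n → Fin n → Set
  ShortcutFrom X a b = a ≡ b ⊎ ∃ λ w → E a w ≡ true × P (X ∪ ⁅ a ⁆) w b

  lastVisit : ∀ {X a x b} → P X x b → P (X ∪ ⁅ a ⁆) x b ⊎ ShortcutFrom X a b
  lastVisit {a = a} {x} (here x∉) with x ≟ a
  ... | yes x≡a = inj₂ (inj₁ (sym x≡a))
  ... | no x≢a = inj₁ (here (∉∪ x∉ (x≢y⇒x∉⁅y⁆ x≢a)))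
  lastVisit {a = a} {x} (step {w = y} x∉ e p) with lastVisit p
  ... | inj₂ r = inj₂ r
  ... | inj₁ q with x ≟ a
  ... | yes refl = inj₂ (inj₂ (y , e , q))
  ... | no x≢a = inj₁ (step (∉∪ x∉ (x≢y⇒x∉⁅y⁆ x≢a)) e q)

  shortcut : ∀ {X a b} → P X a b → ShortcutFrom X a b
  shortcut (here _) = inj₁ refl
  shortcut (step {w = w} _ e p) with lastVisit p
  ... | inj₁ q = inj₂ (w , e , q)
  ... | inj₂ r = r

  -- Reachability is decidable.  Search from a in G − X: each step adds the
  -- current vertex to X, so fuel m with n ≤ ∣X∣ + m always suffices.
  path?-fuel : ∀ m X → n ≤ ∣ X ∣ + m → ∀ a b → Dec (P X a b)
  path?-fuel m X fuel a b with a ∈? X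
  ... | yes a∈ = no λ p → start∉ p a∈
  ... | no a∉ with a ≟ b
  ... | yes refl = yes (here a∉)
  path?-fuel zero X fuel a b | no a∉ | no a≢b =
    ⊥-elim (<-irrefl refl (begin-strict
      n                   ≤⟨ fuel ⟩
      ∣ X ∣ + 0            ≡⟨ +-identityʳ _ ⟩
      ∣ X ∣                <⟨ n<1+n _ ⟩
      suc ∣ X ∣            ≡⟨ sym (∣p∪⁅x⁆∣≡1+∣p∣ X a a∉) ⟩
      ∣ X ∪ ⁅ a ⁆ ∣        ≤⟨ ∣p∣≤n (X ∪ ⁅ a ⁆) ⟩
      n                   ∎))
    where open ≤-Reasoning
  path?-fuel (suc m) X fuel a b | no a∉ | no a≢b
    with any? (λ w → (E a w ≟ᵇ true) ×-dec path?-fuel m (X ∪ ⁅ a ⁆) fuel′ w b)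
    where
    fuel′ : n ≤ ∣ X ∪ ⁅ a ⁆ ∣ + m
    fuel′ = ≤-trans fuel (≤-reflexive (trans (+-suc _ m) (cong (_+ m) (sym (∣p∪⁅x⁆∣≡1+∣p∣ X a a∉)))))
  ... | yes (w , e , p) = yes (step a∉ e (P-mono (p⊆p∪q _) p))
  ... | no ¬w = no λ p → [ a≢b , (λ (w , e , q) → ¬w (w , e , q)) ]′ (shortcut p)

  path? : ∀ X a b → Dec (P X a b)
  path? X a b = path?-fuel n X (m≤n+m n _) a b

-- Cuts between a source set S and the terminals T in the graph G − D, where
-- D is a set of already deleted vertices.  The counting argument recurses
-- by enlarging S or D, so every notion is relative to both.
module Cuts {n : ℕ} (E : Digraph n) (V∞ T : Subset n) where
  open Paths E

  ReachedBy : Subset n → Subset n → Subset n → Fin n → Set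
  ReachedBy S D W v = ∃ λ s → s ∈ S × P (D ∪ W) s v

  reachedBy? : ∀ S D W → Decidable (ReachedBy S D W)
  reachedBy? S D W v = any? (λ s → (s ∈? S) ×-dec path? (D ∪ W) s v)

  R⁺ : Subset n → Subset n → Subset n → Subset n
  R⁺ S D W = select (reachedBy? S D W)

  R⁺-intro : ∀ {S D W s v} → s ∈ S → P (D ∪ W) s v → v ∈ R⁺ S D W
  R⁺-intro {S} {D} {W} {s} s∈S p = ∈-select⁺ (reachedBy? S D W) (s , s∈S , p)

  R⁺-elim : ∀ {S D W v} → v ∈ R⁺ S D W → ReachedBy S D W v
  R⁺-elim {S} {D} {W} = ∈-select⁻ (reachedBy? S D W)

  OutNeighbour : Subset n → Subset n → Fin n → Set
  OutNeighbour D Q v = v ∉ Q × v ∉ D × ∃ λ q → q ∈ Q × E q v ≡ true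

  outNeighbour? : ∀ D Q → Decidable (OutNeighbour D Q)
  outNeighbour? D Q v =
    ¬? (v ∈? Q) ×-dec ¬? (v ∈? D) ×-dec any? (λ q → (q ∈? Q) ×-dec (E q v ≟ᵇ true))

  ∂ : Subset n → Subset n → Subset n
  ∂ D Q = select (outNeighbour? D Q)

  ∂-intro : ∀ {D Q v q} → v ∉ Q → v ∉ D → q ∈ Q → E q v ≡ true → v ∈ ∂ D Q
  ∂-intro {D} {Q} {v} {q} v∉Q v∉D q∈Q e = ∈-select⁺ (outNeighbour? D Q) (v∉Q , v∉D , q , q∈Q , e)

  ∂-elim : ∀ {D Q v} → v ∈ ∂ D Q → OutNeighbour D Q v
  ∂-elim {D} {Q} = ∈-select⁻ (outNeighbour? D Q)

  record Deletable (S D : Subset n) (x : Fin n) : Set where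
    constructor deletable
    field
      ∉S  : x ∉ S
      ∉T  : x ∉ T
      ∉V∞ : x ∉ V∞
      ∉D  : x ∉ D

  deletable? : ∀ S D → Decidable (Deletable S D)
  deletable? S D x =
    map′ (λ (a , b , c , d) → deletable a b c d) (λ (deletable a b c d) → a , b , c , d)
         (¬? (x ∈? S) ×-dec ¬? (x ∈? T) ×-dec ¬? (x ∈? V∞) ×-dec ¬? (x ∈? D))

  record Cut (S D W : Subset n) : Set where
    field
      allowed   : ∀ {x} → x ∈ W → Deletable S D x
      separates : ∀ {s t} → s ∈ S → t ∈ T → ¬ P (D ∪ W) s t

  cut? : ∀ S D W → Dec (Cut S D W)
  cut? S D W =
    map′ (λ (a , b) → record { allowed = λ {x} → a x ; separates = λ {s} {t} → b s t })
         (λ c → (λ x → Cut.allowed c {x}) , (λ s t → Cut.separates c {s} {t}))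
         (all? (λ x → (x ∈? W) →-dec deletable? S D x) ×-dec
          all? (λ s → all? (λ t → (s ∈? S) →-dec (t ∈? T) →-dec ¬? (path? (D ∪ W) s t))))

  Minimal : Subset n → Subset n → Subset n → Set
  Minimal S D W = ∀ {w} → w ∈ W → ¬ Cut S D (W ∩ ∁ ⁅ w ⁆)

  record Important (S D W : Subset n) : Set where
    field
      cut     : Cut S D W
      minimal : Minimal S D W
      maximal : ∀ {W′} → Cut S D W′ → ∣ W′ ∣ ≤ ∣ W ∣ →
                R⁺ S D W ⊆ R⁺ S D W′ → R⁺ S D W′ ⊆ R⁺ S D W

  record Source (S D : Subset n) : Set where
    field
      ∉D : ∀ {x} → x ∈ S → x ∉ D
      ∉T : ∀ {x} → x ∈ S → x ∉ T

  Cut-grow : ∀ {S D X Y} → Cut S D X → X ⊆ Y → (∀ {y} → y ∈ Y → Deletable S D y) → Cut S D Y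
  Cut-grow cX X⊆Y Y-ok = record
    { allowed   = Y-ok
    ; separates = λ s∈S t∈T p → Cut.separates cX s∈S t∈T (P-mono (λ x∈ → [ ∈∪ˡ , ∈∪ʳ ∘ X⊆Y ]′ (x∈p∪q⁻ _ _ x∈)) p)
    }

  module _ {S D : Subset n} where

    R⁺∉W : ∀ {W x} → x ∈ R⁺ S D W → x ∉ W
    R⁺∉W x∈R x∈W = let (_ , _ , p) = R⁺-elim x∈R in end∉ p (∈∪ʳ x∈W)

    R⁺∉D : ∀ {W x} → x ∈ R⁺ S D W → x ∉ D
    R⁺∉D x∈R x∈D = let (_ , _ , p) = R⁺-elim x∈R in end∉ p (∈∪ˡ x∈D)

    R⁺-step : ∀ {W x y} → x ∈ R⁺ S D W → E x y ≡ true → y ∉ D → y ∉ W → y ∈ R⁺ S D W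
    R⁺-step x∈R e y∉D y∉W = let (_ , s∈S , p) = R⁺-elim x∈R in R⁺-intro s∈S (snoc p e (∉∪ y∉D y∉W))

    R⁺-avoids-T : ∀ {W x} → Cut S D W → x ∈ R⁺ S D W → x ∉ T
    R⁺-avoids-T cW x∈R x∈T = let (_ , s∈S , p) = R⁺-elim x∈R in Cut.separates cW s∈S x∈T p

    source⊆R⁺ : ∀ {W} → Source S D → Cut S D W → S ⊆ R⁺ S D W
    source⊆R⁺ src cW s∈S =
      R⁺-intro s∈S (here (∉∪ (Source.∉D src s∈S) (λ s∈W → Deletable.∉S (Cut.allowed cW s∈W) s∈S)))

    ∂R⁺⊆W : ∀ {W} → ∂ D (R⁺ S D W) ⊆ W
    ∂R⁺⊆W {W} {y} y∈∂ with ∂-elim y∈∂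
    ... | y∉R , y∉D , x , x∈R , e with y ∈? W
    ... | yes y∈W = y∈W
    ... | no y∉W = ⊥-elim (y∉R (R⁺-step x∈R e y∉D y∉W))

    Closed : Subset n → Set
    Closed Q = ∀ {q} → q ∈ Q → ∃ λ s → s ∈ S × P (D ∪ ∁ Q) s q

    R⁺-closed : ∀ W → Closed (R⁺ S D W)
    R⁺-closed W q∈R = let (s , s∈S , p) = R⁺-elim q∈R in s , s∈S , stayInside p (R⁺-intro s∈S (here (start∉ p)))
      where
      stayInside : ∀ {a b} → P (D ∪ W) a b → a ∈ R⁺ S D W → P (D ∪ ∁ (R⁺ S D W)) a b
      stayInside (here _) a∈R = here (∉∪ (R⁺∉D a∈R) (x∈p⇒x∉∁p a∈R))
      stayInside (step _ e p) a∈R =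
        step (∉∪ (R⁺∉D a∈R) (x∈p⇒x∉∁p a∈R)) e
             (stayInside p (R⁺-step a∈R e (λ c∈D → start∉ p (∈∪ˡ c∈D)) (λ c∈W → start∉ p (∈∪ʳ c∈W))))

    closed-∪ : ∀ {A B} → Closed A → Closed B → Closed (A ∪ B)
    closed-∪ {A} {B} clA clB q∈ with x∈p∪q⁻ A B q∈
    ... | inj₁ q∈A = let (s , s∈S , p) = clA q∈A in s , s∈S , P-mono (∪∁-anti (p⊆p∪q B)) p
    ... | inj₂ q∈B = let (s , s∈S , p) = clB q∈B in s , s∈S , P-mono (∪∁-anti (q⊆p∪q A B)) p

    trapped : ∀ {Q a b} → P (D ∪ ∂ D Q) a b → a ∈ Q → b ∈ Q
    trapped (here _) a∈Q = a∈Q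
    trapped {Q} (step {w = c} _ e p) a∈Q with c ∈? Q
    ... | yes c∈Q = trapped p c∈Q
    ... | no c∉Q = ⊥-elim (start∉ p (∈∪ʳ (∂-intro c∉Q (λ c∈D → start∉ p (∈∪ˡ c∈D)) a∈Q e)))

    ∂-cut : ∀ {Q} → S ⊆ Q → (∀ {x} → x ∈ Q → x ∉ T) →
            (∀ {x} → x ∈ ∂ D Q → x ∉ T × x ∉ V∞) → Cut S D (∂ D Q)
    ∂-cut S⊆Q Q∩T=∅ ∂-ok = record
      { allowed   = λ x∈∂ → let (x∉Q , x∉D , _) = ∂-elim x∈∂ ; (x∉T , x∉V∞) = ∂-ok x∈∂ in
                            deletable (λ x∈S → x∉Q (S⊆Q x∈S)) x∉T x∉V∞ x∉D
      ; separates = λ s∈S t∈T p → Q∩T=∅ (trapped p (S⊆Q s∈S)) t∈T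
      }

    -- In a minimal cut every vertex w has an in-neighbour in the reach set:
    -- some S–T path survives in G − (D ∪ (W − w)), and where it leaves the
    -- reach set it must enter w.
    minimal-inNeighbour : ∀ {W w} → Source S D → Cut S D W → Minimal S D W → w ∈ W →
                          ∃ λ r → r ∈ R⁺ S D W × E r w ≡ true
    minimal-inNeighbour {W} {w} src cW minW w∈W
      with any? (λ s → any? (λ t → (s ∈? S) ×-dec (t ∈? T) ×-dec path? (D ∪ (W ∩ ∁ ⁅ w ⁆)) s t))
    ... | no noPath = ⊥-elim (minW w∈W (record
          { allowed   = Cut.allowed cW ∘ proj₁ ∘ x∈p∩q⁻ W _
          ; separates = λ {s} {t} s∈S t∈T p → noPath (s , t , s∈S , t∈T , p) }))
    ... | yes (s , t , s∈S , t∈T , p)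
      with exitArc {Q = R⁺ S D W} p (source⊆R⁺ src cW s∈S) (λ t∈R → R⁺-avoids-T cW t∈R t∈T)
    ... | r , d , r∈R , d∉R , e , d∉ with d ≟ w
    ... | yes refl = r , r∈R , e
    ... | no d≢w = ⊥-elim (d∉R (R⁺-step r∈R e (d∉ ∘ ∈∪ˡ)
                     (λ d∈W → d∉ (∈∪ʳ (x∈p∩q⁺ (d∈W , x∉p⇒x∈∁p (x≢y⇒x∉⁅y⁆ d≢w)))))))

    ∂R⁺-cut : ∀ {W} → Source S D → Cut S D W → Cut S D (∂ D (R⁺ S D W))
    ∂R⁺-cut src cW = ∂-cut (source⊆R⁺ src cW) (R⁺-avoids-T cW)
      (λ x∈ → let d = Cut.allowed cW (∂R⁺⊆W x∈) in Deletable.∉T d , Deletable.∉V∞ d)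

    minimal-empty : ∀ {W} → Cut S D ⊥ → Cut S D W → Minimal S D W → W ≡ ⊥
    minimal-empty {W} c⊥ cW minW = Empty-unique λ (w , w∈W) →
      minW w∈W (Cut-grow c⊥ (λ x∈⊥ → ⊥-elim (∉⊥ x∈⊥)) (Cut.allowed cW ∘ proj₁ ∘ x∈p∩q⁻ W _))

    Q⊆R⁺∂Q : ∀ {Q} → Closed Q → Q ⊆ R⁺ S D (∂ D Q)
    Q⊆R⁺∂Q clQ q∈Q = let (s , s∈S , p) = clQ q∈Q in R⁺-intro s∈S (P-mono D∪∂Q⊆D∪∁Q p)
      where
      D∪∂Q⊆D∪∁Q : ∀ {Q} → D ∪ ∂ D Q ⊆ D ∪ ∁ Q
      D∪∂Q⊆D∪∁Q x∈ = [ ∈∪ˡ , (λ x∈∂ → ∈∪ʳ (x∉p⇒x∈∁p (proj₁ (∂-elim x∈∂)))) ]′ (x∈p∪q⁻ D _ x∈)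

  R⁺-mono-S : ∀ {S S′ D W} → S ⊆ S′ → R⁺ S D W ⊆ R⁺ S′ D W
  R⁺-mono-S S⊆S′ x∈R = let (_ , s∈S , p) = R⁺-elim x∈R in R⁺-intro (S⊆S′ s∈S) p

  R⁺-anti : ∀ {S D W D′ W′} → D ∪ W ⊆ D′ ∪ W′ → R⁺ S D′ W′ ⊆ R⁺ S D W
  R⁺-anti ⊆′ x∈R = let (_ , s∈S , p) = R⁺-elim x∈R in R⁺-intro s∈S (P-mono ⊆′ p)

  Cut-anti-S : ∀ {S S′ D W} → S ⊆ S′ → Cut S′ D W → Cut S D W
  Cut-anti-S S⊆S′ cW = record
    { allowed   = λ x∈W → let deletable a b c d = Cut.allowed cW x∈W in
                          deletable (λ x∈S → a (S⊆S′ x∈S)) b c d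
    ; separates = λ s∈S → Cut.separates cW (S⊆S′ s∈S)
    }

  R⁺-absorb : ∀ {S D W u} → u ∈ R⁺ S D W → R⁺ (S ∪ ⁅ u ⁆) D W ⊆ R⁺ S D W
  R⁺-absorb {S} {u = u} u∈R x∈R with R⁺-elim x∈R
  ... | s , s∈S+u , p with x∈p∪q⁻ S _ s∈S+u
  ... | inj₁ s∈S = R⁺-intro s∈S p
  ... | inj₂ s∈u with x∈⁅y⁆⇒x≡y u s∈u
  ... | refl = let (s′ , s′∈S , q) = R⁺-elim u∈R in R⁺-intro s′∈S (q ++ᴾ p)

  module _ {D : Subset n} where

    ∂∪⊆ : ∀ A B → ∂ D (A ∪ B) ⊆ ∂ D A ∪ ∂ D B
    ∂∪⊆ A B v∈ with ∂-elim v∈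
    ... | v∉A∪B , v∉D , q , q∈A∪B , e with x∈p∪q⁻ A B q∈A∪B
    ... | inj₁ q∈A = ∈∪ˡ (∂-intro (λ v∈A → v∉A∪B (∈∪ˡ v∈A)) v∉D q∈A e)
    ... | inj₂ q∈B = ∈∪ʳ (∂-intro (λ v∈B → v∉A∪B (∈∪ʳ v∈B)) v∉D q∈B e)

    ∂∩⊆ : ∀ A B → ∂ D (A ∩ B) ⊆ ∂ D A ∪ ∂ D B
    ∂∩⊆ A B {v} v∈ with ∂-elim v∈
    ... | v∉A∩B , v∉D , q , q∈A∩B , e with x∈p∩q⁻ A B q∈A∩B | v ∈? A
    ... | q∈A , q∈B | yes v∈A = ∈∪ʳ (∂-intro (λ v∈B → v∉A∩B (x∈p∩q⁺ (v∈A , v∈B))) v∉D q∈B e)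
    ... | q∈A , q∈B | no v∉A = ∈∪ˡ (∂-intro v∉A v∉D q∈A e)

    ∂∪∩∂∩⊆ : ∀ A B → ∂ D (A ∪ B) ∩ ∂ D (A ∩ B) ⊆ ∂ D A ∩ ∂ D B
    ∂∪∩∂∩⊆ A B v∈ with x∈p∩q⁻ _ _ v∈
    ... | v∈∂∪ , v∈∂∩ with ∂-elim v∈∂∪ | ∂-elim v∈∂∩
    ... | v∉A∪B , v∉D , _ | _ , _ , q , q∈A∩B , e with x∈p∩q⁻ A B q∈A∩B
    ... | q∈A , q∈B = x∈p∩q⁺ (∂-intro (λ v∈A → v∉A∪B (∈∪ˡ v∈A)) v∉D q∈A e ,
                              ∂-intro (λ v∈B → v∉A∪B (∈∪ʳ v∈B)) v∉D q∈B e)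

    ∂-submodular : ∀ A B → ∣ ∂ D (A ∪ B) ∣ + ∣ ∂ D (A ∩ B) ∣ ≤ ∣ ∂ D A ∣ + ∣ ∂ D B ∣
    ∂-submodular A B = begin
      ∣ X ∣ + ∣ Y ∣                          ≡⟨ sym (∣p∪q∣+∣p∩q∣≡∣p∣+∣q∣ X Y) ⟩
      ∣ X ∪ Y ∣ + ∣ X ∩ Y ∣                  ≤⟨ +-mono-≤ (p⊆q⇒∣p∣≤∣q∣ X∪Y⊆) (p⊆q⇒∣p∣≤∣q∣ (∂∪∩∂∩⊆ A B)) ⟩
      ∣ ∂ D A ∪ ∂ D B ∣ + ∣ ∂ D A ∩ ∂ D B ∣  ≡⟨ ∣p∪q∣+∣p∩q∣≡∣p∣+∣q∣ (∂ D A) (∂ D B) ⟩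
      ∣ ∂ D A ∣ + ∣ ∂ D B ∣                  ∎
      where
      open ≤-Reasoning
      X = ∂ D (A ∪ B)
      Y = ∂ D (A ∩ B)
      X∪Y⊆ : X ∪ Y ⊆ ∂ D A ∪ ∂ D B
      X∪Y⊆ v∈ = [ ∂∪⊆ A B , ∂∩⊆ A B ]′ (x∈p∪q⁻ X Y v∈)

module MinimumCuts {n : ℕ} (E : Digraph n) (V∞ T : Subset n) where
  open Cuts E V∞ T

  module _ {S D : Subset n} where

    record Uncrossed (A B W₁ W₂ : Subset n) (λ* : ℕ) : Set where
      field
        isCut  : Cut S D (∂ D (A ∪ B))
        covers : A ∪ B ⊆ R⁺ S D (∂ D (A ∪ B))
        small  : ∣ ∂ D (A ∪ B) ∣ + λ* ≤ ∣ W₁ ∣ + ∣ W₂ ∣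

    -- Uncrossing: let A and B contain S and avoid T.  Since ∂(A ∩ B) is a cut
    -- too (so of size ≥ λ*), submodularity makes ∂(A ∪ B) a cut reaching
    -- A ∪ B of size at most ∣W₁∣ + ∣W₂∣ − λ*.
    uncross : ∀ λ* {A B W₁ W₂} → (∀ {X} → Cut S D X → λ* ≤ ∣ X ∣) →
              Cut S D W₁ → Cut S D W₂ → ∂ D A ⊆ W₁ → ∂ D B ⊆ W₂ → S ⊆ A → S ⊆ B →
              (∀ {x} → x ∈ A → x ∉ T) → (∀ {x} → x ∈ B → x ∉ T) → Closed (A ∪ B) →
              Uncrossed A B W₁ W₂ λ*
    uncross λ* {A} {B} {W₁} {W₂} λ*≤ cW₁ cW₂ ∂A⊆W₁ ∂B⊆W₂ S⊆A S⊆B A∩T=∅ B∩T=∅ clA∪B = record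
      { isCut  = ∂-cut (λ s∈S → ∈∪ˡ (S⊆A s∈S)) (λ x∈ → [ A∩T=∅ , B∩T=∅ ]′ (x∈p∪q⁻ A B x∈))
                       (λ x∈ → ok (∂∪⊆ A B x∈))
      ; covers = Q⊆R⁺∂Q clA∪B
      ; small  = begin
          ∣ ∂ D (A ∪ B) ∣ + λ*              ≤⟨ +-monoʳ-≤ ∣ ∂ D (A ∪ B) ∣ (λ*≤ cut∩) ⟩
          ∣ ∂ D (A ∪ B) ∣ + ∣ ∂ D (A ∩ B) ∣ ≤⟨ ∂-submodular A B ⟩
          ∣ ∂ D A ∣ + ∣ ∂ D B ∣             ≤⟨ +-mono-≤ (p⊆q⇒∣p∣≤∣q∣ ∂A⊆W₁) (p⊆q⇒∣p∣≤∣q∣ ∂B⊆W₂) ⟩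
          ∣ W₁ ∣ + ∣ W₂ ∣                   ∎
      }
      where
      open ≤-Reasoning
      ok : ∀ {x} → x ∈ ∂ D A ∪ ∂ D B → x ∉ T × x ∉ V∞
      ok x∈ with x∈p∪q⁻ (∂ D A) _ x∈
      ... | inj₁ x∈∂A = let d = Cut.allowed cW₁ (∂A⊆W₁ x∈∂A) in Deletable.∉T d , Deletable.∉V∞ d
      ... | inj₂ x∈∂B = let d = Cut.allowed cW₂ (∂B⊆W₂ x∈∂B) in Deletable.∉T d , Deletable.∉V∞ d
      cut∩ : Cut S D (∂ D (A ∩ B))
      cut∩ = ∂-cut (λ s∈S → x∈p∩q⁺ (S⊆A s∈S , S⊆B s∈S)) (λ x∈ → A∩T=∅ (proj₁ (x∈p∩q⁻ A B x∈)))
                   (λ x∈ → ok (∂∩⊆ A B x∈))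

    record ExtremalCut : Set where
      field
        C       : Subset n
        cut     : Cut S D C
        minimum : ∀ {X} → Cut S D X → ∣ C ∣ ≤ ∣ X ∣
        extreme : ∀ {X} → Cut S D X → ∣ X ∣ ≤ ∣ C ∣ → ∣ R⁺ S D X ∣ ≤ ∣ R⁺ S D C ∣

    extremalCut : ∀ {W} → Cut S D W → ExtremalCut
    extremalCut {W} cW = record
      { C       = C
      ; cut     = proj₁ C-ok
      ; minimum = λ cX → ≤-trans (proj₂ C-ok) (C₀-min _ cX)
      ; extreme = λ {X} cX X≤C → ≮⇒≥ λ RC<RX →
          <⇒≱ (∸-monoʳ-< RC<RX (∣p∣≤n (R⁺ S D X))) (C-max X (cX , ≤-trans X≤C (proj₂ C-ok)))
      }
      where
      minSize = minimiser (cut? S D) ∣_∣ (W , cW)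
      C₀ = proj₁ minSize
      C₀-min = proj₂ (proj₂ minSize)
      maxReach = minimiser (λ X → cut? S D X ×-dec (∣ X ∣ ≤? ∣ C₀ ∣)) (λ X → n ∸ ∣ R⁺ S D X ∣)
                           (C₀ , proj₁ (proj₂ minSize) , ≤-refl)
      C = proj₁ maxReach
      C-ok = proj₁ (proj₂ maxReach)
      C-max = proj₂ (proj₂ maxReach)

-- Fix an extremal cut C and a vertex u on the boundary
-- of its reach set.  An important cut avoiding u stays important when u is
-- pushed into the sources, which raises the minimum cut size (Pushing); an
-- important cut containing u stays important, minus u, when u is deleted
-- from the graph (Deleting).
module Branching {n : ℕ} (E : Digraph n) (V∞ T : Subset n) where
  open Paths E
  open Cuts E V∞ T
  open MinimumCuts E V∞ T

  module Pushing {S D : Subset n} (src : Source S D) (ec : ExtremalCut {S} {D})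
                 {u : Fin n} (u∈∂ : u ∈ ∂ D (R⁺ S D (ExtremalCut.C ec))) where
    open ExtremalCut ec

    Rc : Subset n
    Rc = R⁺ S D C

    u∉Rc : u ∉ Rc
    u∉Rc = proj₁ (∂-elim u∈∂)

    u-deletable : Deletable S D u
    u-deletable = Cut.allowed cut (∂R⁺⊆W u∈∂)

    u-inNeighbour : ∃ λ r → r ∈ Rc × E r u ≡ true
    u-inNeighbour = proj₂ (proj₂ (∂-elim u∈∂))

    source⁺ : Source (S ∪ ⁅ u ⁆) D
    source⁺ = record
      { ∉D = λ x∈ → [ Source.∉D src , (λ x∈u → subst (_∉ D) (sym (x∈⁅y⁆⇒x≡y u x∈u)) (Deletable.∉D u-deletable)) ]′
                      (x∈p∪q⁻ S _ x∈)
      ; ∉T = λ x∈ → [ Source.∉T src , (λ x∈u → subst (_∉ T) (sym (x∈⁅y⁆⇒x≡y u x∈u)) (Deletable.∉T u-deletable)) ]′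
                      (x∈p∪q⁻ S _ x∈)
      }

    -- Every important cut reaches at least as far as the extremal cut:
    -- uncrossing it with C gives a cut no larger reaching further.
    Rc⊆important : ∀ {W} → Important S D W → Rc ⊆ R⁺ S D W
    Rc⊆important {W} iW x∈Rc =
      Important.maximal iW isCut (+-cancelʳ-≤ ∣ C ∣ _ _ small) (λ y∈ → covers (∈∪ˡ y∈)) (covers (∈∪ʳ x∈Rc))
      where
      cW = Important.cut iW
      open Uncrossed (uncross ∣ C ∣ minimum cW cut ∂R⁺⊆W ∂R⁺⊆W (source⊆R⁺ src cW) (source⊆R⁺ src cut)
                              (R⁺-avoids-T cW) (R⁺-avoids-T cut) (closed-∪ (R⁺-closed W) (R⁺-closed C)))

    -- Once u is a source every cut is larger than C: a cut X with ∣X∣ ≤ ∣C∣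
    -- would uncross with C into a minimum cut reaching beyond Rc (to u).
    pushed-λ : ∀ {X} → Cut (S ∪ ⁅ u ⁆) D X → suc ∣ C ∣ ≤ ∣ X ∣
    pushed-λ {X} cX = ≰⇒> λ X≤C → <-irrefl refl (begin-strict
        ∣ Rc ∣                    <⟨ p⊂q⇒∣p∣<∣q∣ (q⊆p∪q A Rc , u , ∈∪ˡ u∈A , u∉Rc) ⟩
        ∣ A ∪ Rc ∣                ≤⟨ p⊆q⇒∣p∣≤∣q∣ covers ⟩
        ∣ R⁺ S D (∂ D (A ∪ Rc)) ∣ ≤⟨ extreme isCut (+-cancelʳ-≤ ∣ C ∣ _ _ (≤-trans small (+-monoˡ-≤ ∣ C ∣ X≤C))) ⟩
        ∣ Rc ∣                    ∎)
      where
      open ≤-Reasoning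
      A = R⁺ (S ∪ ⁅ u ⁆) D X
      u∈A : u ∈ A
      u∈A = source⊆R⁺ source⁺ cX (∈∪ʳ (x∈⁅x⁆ u))
      -- u, hence all of A, is reachable from S inside A ∪ Rc via the arc r → u.
      closed : Closed {S} {D} (A ∪ Rc)
      closed q∈ with x∈p∪q⁻ A Rc q∈
      ... | inj₂ q∈Rc = let (s , s∈S , p) = R⁺-closed C q∈Rc in s , s∈S , P-mono (∪∁-anti (q⊆p∪q A Rc)) p
      ... | inj₁ q∈A with R⁺-closed X q∈A
      ... | s , s∈S+u , p with x∈p∪q⁻ S _ s∈S+u
      ... | inj₁ s∈S = s , s∈S , P-mono (∪∁-anti (p⊆p∪q Rc)) p
      ... | inj₂ s∈u with x∈⁅y⁆⇒x≡y u s∈u | u-inNeighbour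
      ... | refl | r , r∈Rc , r→u =
        let (s′ , s′∈S , pr) = R⁺-closed C r∈Rc
            u∉D∪∁ = ∉∪ (Deletable.∉D u-deletable) (x∈p⇒x∉∁p (∈∪ˡ u∈A))
        in s′ , s′∈S , snoc (P-mono (∪∁-anti (q⊆p∪q A Rc)) pr) r→u u∉D∪∁ ++ᴾ P-mono (∪∁-anti (p⊆p∪q Rc)) p
      open Uncrossed (uncross ∣ C ∣ minimum (Cut-anti-S (p⊆p∪q _) cX) cut ∂R⁺⊆W ∂R⁺⊆W
                              (source⊆R⁺ source⁺ cX ∘ ∈∪ˡ) (source⊆R⁺ src cut)
                              (R⁺-avoids-T cX) (R⁺-avoids-T cut) closed)

    push : ∀ {W} → Important S D W → u ∉ W → Important (S ∪ ⁅ u ⁆) D W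
    push {W} iW u∉W = record
      { cut     = record { allowed = allowed⁺ ; separates = separates⁺ }
      ; minimal = λ w∈W c → Important.minimal iW w∈W (Cut-anti-S (p⊆p∪q _) c)
      ; maximal = maximal⁺
      }
      where
      cW = Important.cut iW
      u∈RW : u ∈ R⁺ S D W
      u∈RW = let (r , r∈Rc , r→u) = u-inNeighbour in
             R⁺-step (Rc⊆important iW r∈Rc) r→u (Deletable.∉D u-deletable) u∉W
      allowed⁺ : ∀ {x} → x ∈ W → Deletable (S ∪ ⁅ u ⁆) D x
      allowed⁺ {x} x∈W = let deletable x∉S x∉T x∉V∞ x∉D = Cut.allowed cW x∈W in
        deletable (λ x∈ → [ x∉S , (λ x∈u → u∉W (subst (_∈ W) (x∈⁅y⁆⇒x≡y u x∈u) x∈W)) ]′ (x∈p∪q⁻ S _ x∈))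
                  x∉T x∉V∞ x∉D
      separates⁺ : ∀ {s t} → s ∈ S ∪ ⁅ u ⁆ → t ∈ T → ¬ P (D ∪ W) s t
      separates⁺ s∈ t∈T p = R⁺-avoids-T cW (R⁺-absorb u∈RW (R⁺-intro s∈ p)) t∈T
      maximal⁺ : ∀ {W′} → Cut (S ∪ ⁅ u ⁆) D W′ → ∣ W′ ∣ ≤ ∣ W ∣ →
                 R⁺ (S ∪ ⁅ u ⁆) D W ⊆ R⁺ (S ∪ ⁅ u ⁆) D W′ → R⁺ (S ∪ ⁅ u ⁆) D W′ ⊆ R⁺ (S ∪ ⁅ u ⁆) D W
      maximal⁺ {W′} cW′ W′≤W R⊆R′ x∈R′ =
        R⁺-mono-S (p⊆p∪q _)
          (Important.maximal iW (Cut-anti-S (p⊆p∪q _) cW′) W′≤W RW⊆RW′ (R⁺-absorb (RW⊆RW′ u∈RW) x∈R′))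
        where
        -- A path inside R⁺ S D W meets no vertex of W′, as these lie outside the
        -- enlarged reach set R⁺ (S ∪ ⁅u⁆) D W′ ⊇ R⁺ S D W.
        RW⊆RW′ : R⁺ S D W ⊆ R⁺ S D W′
        RW⊆RW′ y∈ = let (s , s∈S , p) = R⁺-closed W y∈ in R⁺-intro s∈S (P-mono avoid p)
          where
          avoid : D ∪ W′ ⊆ D ∪ ∁ (R⁺ S D W)
          avoid z∈ = [ ∈∪ˡ , (λ z∈W′ → ∈∪ʳ (x∉p⇒x∈∁p (λ z∈R → R⁺∉W (R⊆R′ (R⁺-mono-S (p⊆p∪q _) z∈R)) z∈W′))) ]′
                       (x∈p∪q⁻ D W′ z∈)

  module Deleting {S D : Subset n} {u : Fin n} (u-deletable : Deletable S D u) where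

    Cut-restore : ∀ {Y} → Cut S (D ∪ ⁅ u ⁆) Y → Cut S D (Y ∪ ⁅ u ⁆)
    Cut-restore {Y} cY = record
      { allowed   = λ x∈ → [ weaken ∘ Cut.allowed cY , (λ x∈u → subst (Deletable S D) (sym (x∈⁅y⁆⇒x≡y u x∈u)) u-deletable) ]′
                             (x∈p∪q⁻ Y _ x∈)
      ; separates = λ s∈S t∈T p → Cut.separates cY s∈S t∈T (P-mono (⊆-reflexive (∪-rearrange D ⁅ u ⁆ Y)) p)
      }
      where
      weaken : ∀ {x} → Deletable S (D ∪ ⁅ u ⁆) x → Deletable S D x
      weaken (deletable x∉S x∉T x∉V∞ x∉D∪u) = deletable x∉S x∉T x∉V∞ (x∉D∪u ∘ ∈∪ˡ)

    module _ {W : Subset n} (u∈W : u ∈ W) where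

      W⁻ : Subset n
      W⁻ = W ∩ ∁ ⁅ u ⁆

      W⁻-elim : ∀ {x} → x ∈ W⁻ → x ∈ W × x ≢ u
      W⁻-elim x∈ = let (x∈W , x∈∁u) = x∈p∩q⁻ W _ x∈ in x∈W , λ x≡u → x∈∁p⇒x∉p x∈∁u (subst (_∈ ⁅ u ⁆) (sym x≡u) (x∈⁅x⁆ u))

      W⁻∪⁅u⁆≡W : W⁻ ∪ ⁅ u ⁆ ≡ W
      W⁻∪⁅u⁆≡W = ⊆-antisym (λ x∈ → [ proj₁ ∘ W⁻-elim , (λ x∈u → subst (_∈ W) (sym (x∈⁅y⁆⇒x≡y u x∈u)) u∈W) ]′ (x∈p∪q⁻ W⁻ _ x∈))
                           W⊆W⁻∪⁅u⁆
        where
        W⊆W⁻∪⁅u⁆ : W ⊆ W⁻ ∪ ⁅ u ⁆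
        W⊆W⁻∪⁅u⁆ {x} x∈W with x ≟ u
        ... | yes refl = ∈∪ʳ (x∈⁅x⁆ u)
        ... | no x≢u = ∈∪ˡ (x∈p∩q⁺ (x∈W , x∉p⇒x∈∁p (x≢y⇒x∉⁅y⁆ x≢u)))

      ∣W⁻∣ : suc ∣ W⁻ ∣ ≡ ∣ W ∣
      ∣W⁻∣ = trans (sym (∣p∪⁅x⁆∣≡1+∣p∣ W⁻ u (λ u∈ → proj₂ (W⁻-elim u∈) refl))) (cong ∣_∣ W⁻∪⁅u⁆≡W)

      D∪⁅u⁆∪W⁻≡D∪W : (D ∪ ⁅ u ⁆) ∪ W⁻ ≡ D ∪ W
      D∪⁅u⁆∪W⁻≡D∪W = trans (∪-rearrange D ⁅ u ⁆ W⁻) (cong (D ∪_) W⁻∪⁅u⁆≡W)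

      delete : Important S D W → Important S (D ∪ ⁅ u ⁆) W⁻
      delete iW = record
        { cut     = record
          { allowed   = λ x∈ → let (x∈W , x≢u) = W⁻-elim x∈ ; deletable a b c d = Cut.allowed cW x∈W in
                               deletable a b c (∉∪ d (x≢y⇒x∉⁅y⁆ x≢u))
          ; separates = λ s∈S t∈T p → Cut.separates cW s∈S t∈T (P-mono (⊆-reflexive (sym D∪⁅u⁆∪W⁻≡D∪W)) p)
          }
        ; minimal = minimal⁻
        ; maximal = maximal⁻
        }
        where
        cW = Important.cut iW
        minimal⁻ : Minimal S (D ∪ ⁅ u ⁆) W⁻
        minimal⁻ {w} w∈ c = Important.minimal iW (proj₁ (W⁻-elim w∈))
          (Cut-grow (Cut-restore c) ⊆W-w (Cut.allowed cW ∘ proj₁ ∘ x∈p∩q⁻ W _))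
          where
          ⊆W-w : (W⁻ ∩ ∁ ⁅ w ⁆) ∪ ⁅ u ⁆ ⊆ W ∩ ∁ ⁅ w ⁆
          ⊆W-w x∈ with x∈p∪q⁻ (W⁻ ∩ ∁ ⁅ w ⁆) _ x∈
          ... | inj₁ x∈W⁻-w = let (x∈W⁻ , x∉w) = x∈p∩q⁻ W⁻ _ x∈W⁻-w in x∈p∩q⁺ (proj₁ (W⁻-elim x∈W⁻) , x∉w)
          ... | inj₂ x∈u with x∈⁅y⁆⇒x≡y u x∈u
          ... | refl = x∈p∩q⁺ (u∈W , x∉p⇒x∈∁p (λ u∈w → proj₂ (W⁻-elim w∈) (sym (x∈⁅y⁆⇒x≡y w u∈w))))
        maximal⁻ : ∀ {W′} → Cut S (D ∪ ⁅ u ⁆) W′ → ∣ W′ ∣ ≤ ∣ W⁻ ∣ →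
                   R⁺ S (D ∪ ⁅ u ⁆) W⁻ ⊆ R⁺ S (D ∪ ⁅ u ⁆) W′ → R⁺ S (D ∪ ⁅ u ⁆) W′ ⊆ R⁺ S (D ∪ ⁅ u ⁆) W⁻
        maximal⁻ {W′} cW′ W′≤W⁻ R⊆R′ =
          R⁺-anti (⊆-reflexive D∪⁅u⁆∪W⁻≡D∪W) ∘ Important.maximal iW (Cut-restore cW′) size R⊆R′₊ ∘ R⁺-anti shift
          where
          shift : D ∪ (W′ ∪ ⁅ u ⁆) ⊆ (D ∪ ⁅ u ⁆) ∪ W′
          shift = ⊆-reflexive (sym (∪-rearrange D ⁅ u ⁆ W′))
          R⊆R′₊ : R⁺ S D W ⊆ R⁺ S D (W′ ∪ ⁅ u ⁆)
          R⊆R′₊ = R⁺-anti shift ∘ R⊆R′ ∘ R⁺-anti (⊆-reflexive D∪⁅u⁆∪W⁻≡D∪W)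
          size : ∣ W′ ∪ ⁅ u ⁆ ∣ ≤ ∣ W ∣
          size = begin
            ∣ W′ ∪ ⁅ u ⁆ ∣       ≤⟨ ∣p∪q∣≤∣p∣+∣q∣ W′ ⁅ u ⁆ ⟩
            ∣ W′ ∣ + ∣ ⁅ u ⁆ ∣   ≡⟨ trans (cong (∣ W′ ∣ +_) (∣⁅x⁆∣≡1 u)) (+-comm _ 1) ⟩
            suc ∣ W′ ∣           ≤⟨ s≤s W′≤W⁻ ⟩
            suc ∣ W⁻ ∣           ≡⟨ ∣W⁻∣ ⟩
            ∣ W ∣                ∎
            where open ≤-Reasoning

-- The counting theorem: at most 2^(2k − λ) important cuts of size ≤ k, where
-- λ is a lower bound on all cut sizes; the budget m stands for 2k − λ.
module Counting {n : ℕ} (E : Digraph n) (V∞ T : Subset n) where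
  open Cuts E V∞ T
  open MinimumCuts E V∞ T
  open Branching E V∞ T

  ImportantOfSize≤ : Subset n → Subset n → ℕ → Subset n → Set
  ImportantOfSize≤ S D k W = Important S D W × ∣ W ∣ ≤ k

  count : ∀ m {S D} k λ* → Source S D → (∀ {X} → Cut S D X → λ* ≤ ∣ X ∣) → k + k ≤ λ* + m →
          ∀ Ws → Unique Ws → All (ImportantOfSize≤ S D k) Ws → length Ws ≤ 2 ^ m
  count m k λ* src λ*≤ budget [] _ _ = z≤n
  count m {S} {D} k λ* src λ*≤ budget Ws@(W ∷ _) uniq imps@((iW , W≤k) ∷ _)
    with ec ← extremalCut {S} {D} (Important.cut iW)
    with any? (_∈? ∂ D (R⁺ S D (ExtremalCut.C ec)))
  -- Nothing leaves the extremal reach set: the only important cut is empty.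
  ... | no ∂-empty = ≤-trans (atMostOne uniq (All.map onlyEmpty imps)) (m^n>0 2 m)
    where
    open ExtremalCut ec
    nothingToCut : Cut S D ⊥
    nothingToCut = subst (Cut S D) (Empty-unique ∂-empty) (∂R⁺-cut src cut)
    onlyEmpty : ∀ {W′} → ImportantOfSize≤ S D k W′ → W′ ≡ ⊥
    onlyEmpty (iW′ , _) = minimal-empty nothingToCut (Important.cut iW′) (Important.minimal iW′)
  -- Branch on the boundary vertex u: the important cuts containing u, and
  -- those avoiding it, each fit into budget m − 1.
  ... | yes (u , u∈∂) = branch m budget
    where
    open ExtremalCut ec
    open Pushing src ec u∈∂
    open Deleting u-deletable

    1≤∣C∣ : 1 ≤ ∣ C ∣
    1≤∣C∣ = ≤-trans (≤-reflexive (sym (∣⁅x⁆∣≡1 u))) (p⊆q⇒∣p∣≤∣q∣ λ x∈u → subst (_∈ C) (sym (x∈⁅y⁆⇒x≡y u x∈u)) (∂R⁺⊆W u∈∂))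
    ∣C∣≤k : ∣ C ∣ ≤ k
    ∣C∣≤k = ≤-trans (minimum (Important.cut iW)) W≤k

    With Without : List (Subset n)
    With    = filter (u ∈?_) Ws
    Without = filter (∁? (u ∈?_)) Ws

    -- Cuts containing u, with u deleted from the graph: λ and k drop by one.
    deleted : ∀ m → pred k + pred k ≤ pred ∣ C ∣ + m → length (map (_∩ ∁ ⁅ u ⁆) With) ≤ 2 ^ m
    deleted m budget′ = count m (pred k) (pred ∣ C ∣) source⁻ λ⁻≤ budget′ _
      (map⁺-injectiveOn (_∩ ∁ ⁅ u ⁆) (λ {W₁} {W₂} u∈W₁ u∈W₂ eq →
         trans (sym (W⁻∪⁅u⁆≡W u∈W₁)) (trans (cong (_∪ ⁅ u ⁆) eq) (W⁻∪⁅u⁆≡W u∈W₂)))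
         (Allₚ.all-filter (u ∈?_) Ws) (Uniqueₚ.filter⁺ (u ∈?_) uniq))
      (Allₚ.map⁺ (All.map (λ ((iW′ , W′≤k) , u∈W′) → delete u∈W′ iW′ , pred-mono-≤ (subst (_≤ k) (sym (∣W⁻∣ u∈W′)) W′≤k))
                          (All.zip (Allₚ.filter⁺ (u ∈?_) imps , Allₚ.all-filter (u ∈?_) Ws))))
      where
      source⁻ : Source S (D ∪ ⁅ u ⁆)
      source⁻ = record
        { ∉D = λ x∈S → ∉∪ (Source.∉D src x∈S) (λ x∈u → Deletable.∉S u-deletable (subst (_∈ S) (x∈⁅y⁆⇒x≡y u x∈u) x∈S))
        ; ∉T = Source.∉T src }
      λ⁻≤ : ∀ {Y} → Cut S (D ∪ ⁅ u ⁆) Y → pred ∣ C ∣ ≤ ∣ Y ∣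
      λ⁻≤ {Y} cY = pred-mono-≤ (≤-trans (minimum (Cut-restore cY))
                    (≤-trans (∣p∪q∣≤∣p∣+∣q∣ Y ⁅ u ⁆) (≤-reflexive (trans (cong (∣ Y ∣ +_) (∣⁅x⁆∣≡1 u)) (+-comm _ 1)))))

    -- Cuts avoiding u, with u pushed into the sources: λ rises by one.
    pushed : ∀ m → k + k ≤ suc ∣ C ∣ + m → length Without ≤ 2 ^ m
    pushed m budget′ = count m k (suc ∣ C ∣) source⁺ pushed-λ budget′ Without (Uniqueₚ.filter⁺ (∁? (u ∈?_)) uniq)
      (All.map (λ ((iW′ , W′≤k) , u∉W′) → push iW′ u∉W′ , W′≤k)
               (All.zip (Allₚ.filter⁺ (∁? (u ∈?_)) imps , Allₚ.all-filter (∁? (u ∈?_)) Ws)))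

    branch : ∀ m → k + k ≤ λ* + m → length Ws ≤ 2 ^ m
    branch zero budget =
      ⊥-elim (<-irrefl refl (≤-trans 1≤∣C∣ (≤-trans ∣C∣≤k (budget-large budget (≤-trans (λ*≤ cut) ∣C∣≤k)))))
    branch (suc m) budget = begin
      length Ws                                            ≡⟨ length-split (u ∈?_) Ws ⟩
      length With + length Without                         ≡⟨ cong (_+ length Without) (sym (length-map _ With)) ⟩
      length (map (_∩ ∁ ⁅ u ⁆) With) + length Without      ≤⟨ +-mono-≤ (deleted m (budget-delete {k} budget (λ*≤ cut) 1≤∣C∣ ∣C∣≤k))
                                                                       (pushed m (budget-push {k} budget (λ*≤ cut))) ⟩
      2 ^ m + 2 ^ m                                        ≡⟨ cong (2 ^ m +_) (sym (+-identityʳ _)) ⟩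
      2 ^ suc m                                            ∎
      where open ≤-Reasoning

-- Changing the source.  If W is important for S₁ and at the same time a
-- minimal cut for S₂ (for S₂ = ⁅z⁆: z lies in the exact reverse shadow of W),
-- then W is important for S₂ as well.
module ShadowTransfer {n : ℕ} (E : Digraph n) (V∞ T : Subset n) where
  open Paths E
  open Cuts E V∞ T

  module _ {S₁ S₂ D W : Subset n} (src₁ : Source S₁ D) (src₂ : Source S₂ D)
           (iW : Important S₁ D W) (cW₂ : Cut S₂ D W) (minW₂ : Minimal S₂ D W) where

    R₁ R₂ : Subset n
    R₁ = R⁺ S₁ D W
    R₂ = R⁺ S₂ D W

    cW₁ : Cut S₁ D W
    cW₁ = Important.cut iW

    -- A competitor W′ for S₂ that reaches at least R₂.  Trimming it to the
    -- part W″ outside R₁ yields a cut for S₁ that reaches beyond R₁.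
    module Competitor {W′ : Subset n} (cW′ : Cut S₂ D W′) (R₂⊆R′ : R₂ ⊆ R⁺ S₂ D W′) where

      R′ W″ : Subset n
      R′ = R⁺ S₂ D W′
      W″ = W′ ∩ ∁ R₁

      -- W′ reaches every vertex of W it does not delete, through the
      -- in-neighbour that minimality provides inside R₂.
      W⊆R′∪W′ : ∀ {c} → c ∈ W → c ∈ R′ ∪ W′
      W⊆R′∪W′ {c} c∈W with c ∈? W′
      ... | yes c∈W′ = ∈∪ʳ c∈W′
      ... | no c∉W′ = let (r , r∈R₂ , e) = minimal-inNeighbour src₂ cW₂ minW₂ c∈W in
                      ∈∪ˡ (R⁺-step (R₂⊆R′ r∈R₂) e (Deletable.∉D (Cut.allowed cW₂ c∈W)) c∉W′)

      trapped″ : ∀ {a b} → P (D ∪ W″) a b → a ∈ R₁ ∪ R′ → b ∈ R₁ ∪ R′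
      trapped″ (here _) a∈ = a∈
      trapped″ {a} (step {w = c} _ e p) a∈ = trapped″ p (next (x∈p∪q⁻ R₁ R′ a∈))
        where
        c∉D : c ∉ D
        c∉D = start∉ p ∘ ∈∪ˡ
        c∉W″ : c ∉ W″
        c∉W″ = start∉ p ∘ ∈∪ʳ
        next : a ∈ R₁ ⊎ a ∈ R′ → c ∈ R₁ ∪ R′
        next a∈ with c ∈? W′ | c ∈? R₁
        ... | yes c∈W′ | yes c∈R₁ = ∈∪ˡ c∈R₁
        ... | yes c∈W′ | no c∉R₁ = ⊥-elim (c∉W″ (x∈p∩q⁺ (c∈W′ , x∉p⇒x∈∁p c∉R₁)))
        next (inj₂ a∈R′) | no c∉W′ | _ = ∈∪ʳ (R⁺-step a∈R′ e c∉D c∉W′)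
        next (inj₁ a∈R₁) | no c∉W′ | _ with c ∈? W
        ... | no c∉W = ∈∪ˡ (R⁺-step a∈R₁ e c∉D c∉W)
        ... | yes c∈W = [ ∈∪ʳ , (λ c∈W′ → ⊥-elim (c∉W′ c∈W′)) ]′ (x∈p∪q⁻ R′ W′ (W⊆R′∪W′ c∈W))

      cut″ : Cut S₁ D W″
      cut″ = record
        { allowed   = λ x∈W″ → let (x∈W′ , x∉R₁) = x∈p∩q⁻ W′ _ x∈W″
                                   deletable _ x∉T x∉V∞ x∉D = Cut.allowed cW′ x∈W′ in
                               deletable (λ x∈S₁ → x∈∁p⇒x∉p x∉R₁ (source⊆R⁺ src₁ cW₁ x∈S₁)) x∉T x∉V∞ x∉D
        ; separates = λ {s} {t} s∈S₁ t∈T p →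
            [ (λ t∈R₁ → R⁺-avoids-T cW₁ t∈R₁ t∈T) , (λ t∈R′ → R⁺-avoids-T cW′ t∈R′ t∈T) ]′
              (x∈p∪q⁻ R₁ R′ (trapped″ p (∈∪ˡ (source⊆R⁺ src₁ cW₁ s∈S₁))))
        }

      R₁⊆R″ : R₁ ⊆ R⁺ S₁ D W″
      R₁⊆R″ y∈ = let (s , s∈S₁ , p) = R⁺-closed W y∈ in R⁺-intro s∈S₁ (P-mono D∪W″⊆D∪∁R₁ p)
        where
        D∪W″⊆D∪∁R₁ : D ∪ W″ ⊆ D ∪ ∁ R₁
        D∪W″⊆D∪∁R₁ z∈ = [ ∈∪ˡ , ∈∪ʳ ∘ proj₂ ∘ x∈p∩q⁻ W′ _ ]′ (x∈p∪q⁻ D W″ z∈)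

      W∩R′⊆R″ : ∀ {d} → d ∈ W → d ∈ R′ → d ∈ R⁺ S₁ D W″
      W∩R′⊆R″ d∈W d∈R′ = let (r , r∈R₁ , e) = minimal-inNeighbour src₁ cW₁ (Important.minimal iW) d∈W in
        R⁺-step (R₁⊆R″ r∈R₁) e (R⁺∉D d∈R′) (R⁺∉W d∈R′ ∘ proj₁ ∘ x∈p∩q⁻ W′ _)

    important₂ : Important S₂ D W
    important₂ = record { cut = cW₂ ; minimal = minW₂ ; maximal = maximal₂ }
      where
      -- A vertex x ∈ R′ ∖ R₂ would make an S₂-path cross an arc c → d out of R₂
      -- into W ∩ R′; then d ∈ R⁺ S₁ D W″ ⊆ R₁ by importance of W, yet d ∈ W.
      maximal₂ : ∀ {W′} → Cut S₂ D W′ → ∣ W′ ∣ ≤ ∣ W ∣ → R₂ ⊆ R⁺ S₂ D W′ → R⁺ S₂ D W′ ⊆ R₂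
      maximal₂ {W′} cW′ W′≤W R₂⊆R′ {x} x∈R′ with x ∈? R₂
      ... | yes x∈R₂ = x∈R₂
      ... | no x∉R₂ with R⁺-closed W′ x∈R′
      ... | s , s∈S₂ , p with exitArc p (source⊆R⁺ src₂ cW₂ s∈S₂) x∉R₂
      ... | c , d , c∈R₂ , d∉R₂ , e , d∉ = ⊥-elim (R⁺∉W (Important.maximal iW cut″ W″≤W R₁⊆R″ (W∩R′⊆R″ d∈W d∈R′)) d∈W)
        where
        open Competitor cW′ R₂⊆R′
        d∈R′ : d ∈ R′
        d∈R′ = x∉∁p⇒x∈p (d∉ ∘ ∈∪ʳ)
        d∈W : d ∈ W
        d∈W with d ∈? W
        ... | yes d∈W = d∈W
        ... | no d∉W = ⊥-elim (d∉R₂ (R⁺-step c∈R₂ e (d∉ ∘ ∈∪ˡ) d∉W))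
        W″≤W : ∣ W″ ∣ ≤ ∣ W ∣
        W″≤W = ≤-trans (∣p∩q∣≤∣p∣ W′ _) W′≤W

-- The notions of Defs are the case D = ⊥ of the relative notions above.
module FromDefs {n : ℕ} (E : Digraph n) (V∞ T : Subset n) where
  open Paths E
  open Cuts E V∞ T

  ⊥∪W≡W : ∀ {W : Subset n} → ⊥ ∪ W ≡ W
  ⊥∪W≡W {W} = ∪-identityˡ W

  module _ {S : Subset n} where

    source : ∀ {W} → IsSep E V∞ S T W → Source S ⊥
    source (_ , _ , S∩T=∅ , _) = record { ∉D = λ _ → ∉⊥ ; ∉T = S∩T=∅ _ }

    sep⇒cut : ∀ {W} → IsSep E V∞ S T W → Cut S ⊥ W
    sep⇒cut (_ , _ , _ , ok , sep) = record
      { allowed   = λ x∈W → let (x∉S , x∉T , x∉V∞) = ok _ x∈W in deletable x∉S x∉T x∉V∞ ∉⊥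
      ; separates = λ s∈S t∈T p → sep _ _ s∈S t∈T (P-mono (⊆-reflexive (sym ⊥∪W≡W)) p)
      }

    -- Any cut is a separator, the nonemptiness and disjointness of S and T
    -- being inherited from a given separator.
    cut⇒sep : ∀ {W W′} → IsSep E V∞ S T W → Cut S ⊥ W′ → IsSep E V∞ S T W′
    cut⇒sep (S≠∅ , T≠∅ , S∩T=∅ , _ , _) cW′ =
      S≠∅ , T≠∅ , S∩T=∅ ,
      (λ x x∈W′ → let deletable x∉S x∉T x∉V∞ _ = Cut.allowed cW′ x∈W′ in x∉S , x∉T , x∉V∞) ,
      (λ s t s∈S t∈T p → Cut.separates cW′ s∈S t∈T (P-mono (⊆-reflexive ⊥∪W≡W) p))

    minSep⇒minimal : ∀ {W} → IsMinSep E V∞ S T W → Minimal S ⊥ W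
    minSep⇒minimal (sepW , noSmaller) {w} w∈W c =
      noSmaller _ (proj₁ ∘ x∈p∩q⁻ _ _ , w , w∈W , λ w∈ → x∈∁p⇒x∉p (proj₂ (x∈p∩q⁻ _ _ w∈)) (x∈⁅x⁆ w))
                (cut⇒sep sepW c)

    reach⇒R⁺ : ∀ {W x} → Reach E W S x → x ∈ R⁺ S ⊥ W
    reach⇒R⁺ (a , a∈S , p) = R⁺-intro a∈S (P-mono (⊆-reflexive ⊥∪W≡W) p)

    R⁺⇒reach : ∀ {W x} → x ∈ R⁺ S ⊥ W → Reach E W S x
    R⁺⇒reach x∈R = let (a , a∈S , p) = R⁺-elim x∈R in a , a∈S , P-mono (⊆-reflexive (sym ⊥∪W≡W)) p

    important⇒Important : ∀ {W} → IsImportant E V∞ S T W → Important S ⊥ W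
    important⇒Important {W} (minSep@(sepW , _) , notImproved) = record
      { cut     = sep⇒cut sepW
      ; minimal = minSep⇒minimal minSep
      ; maximal = maximal
      }
      where
      maximal : ∀ {W′} → Cut S ⊥ W′ → ∣ W′ ∣ ≤ ∣ W ∣ → R⁺ S ⊥ W ⊆ R⁺ S ⊥ W′ → R⁺ S ⊥ W′ ⊆ R⁺ S ⊥ W
      maximal {W′} cW′ W′≤W R⊆R′ {x} x∈R′ with x ∈? R⁺ S ⊥ W
      ... | yes x∈R = x∈R
      ... | no x∉R = ⊥-elim (notImproved (W′ , cut⇒sep sepW cW′ , W′≤W ,
                               (λ y → R⁺⇒reach ∘ R⊆R′ ∘ reach⇒R⁺) , x , R⁺⇒reach x∈R′ , x∉R ∘ reach⇒R⁺))

  shadowMember⇒important : ∀ {k z W} → InI E V∞ T k W × InExactRevShadow E V∞ T W z →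
                           Important ⁅ z ⁆ ⊥ W × ∣ W ∣ ≤ k
  shadowMember⇒important ((v , _ , importantV , W≤k) , minSepZ@(sepZ , _)) =
    ShadowTransfer.important₂ E V∞ T (source (proj₁ (proj₁ importantV))) (source sepZ)
      (important⇒Important importantV) (sep⇒cut sepZ) (minSep⇒minimal minSepZ) , W≤k

4^k≡2^[k+k] : ∀ k → 4 ^ k ≡ 2 ^ (k + k)
4^k≡2^[k+k] k = trans (^-*-assoc 2 2 k) (cong (λ j → 2 ^ (k + j)) (+-identityʳ k))

lemma4 : (n : ℕ) (E : Digraph n) (V∞ T : Subset n) (k : ℕ) (z : Fin n)
    (Ws : List (Subset n)) → Unique Ws →
    All (λ W → InI E V∞ T k W × InExactRevShadow E V∞ T W z) Ws →
    length Ws ≤ 4 ^ k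
lemma4 n E V∞ T k z [] _ _ = z≤n
lemma4 n E V∞ T k z Ws@(_ ∷ _) uniq members@((_ , (sepZ , _)) ∷ _) = begin
  length Ws    ≤⟨ Counting.count E V∞ T (k + k) k 0 (source sepZ) (λ _ → z≤n) ≤-refl Ws uniq
                    (All.map shadowMember⇒important members) ⟩
  2 ^ (k + k)  ≡⟨ sym (4^k≡2^[k+k] k) ⟩
  4 ^ k        ∎
  where
  open ≤-Reasoning
  open FromDefs E V∞ T
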